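{- Let $G$ be a linear $r$-uniform hypergraph and let $k$ be a positive integer with $k\le r$. If there exist an edge $e\in E(G)$ and distinct vertices $v_1,v_2,\dots,v_k\in e$ such that $d(v_i)\ge (i-1)(r-1)+2$ for all $i\in\{1,\dots,k\}$, then $G$ contains a copy of $C_{1,k}^r$ whose base edge is $e$.
   Context: An $r$-uniform hypergraph is linear if every pair of vertices lies in at most one edge. $d(v)$ denotes the number of edges containing $v$. The $k$-crown $C_{1,k}^r$ is the linear $r$-graph consisting of one base edge $e$ together with $k$ pairwise disjoint edges $e_1,\dots,e_k$, each intersecting $e$ in exactly one vertex, these $k$ vertices being distinct. -}

module Defs where

open import Data.Nat using (ℕ; _≤_)
open import Data.Fin using (Fin)
open import Data.Fin.Subset using (Subset; _∈_; _∩_; ∣_∣; Empty)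
open import Data.Fin.Subset.Properties using (_∈?_)
open import Data.List using (List; length; filter)
open import Data.List.Membership.Propositional renaming (_∈_ to _∈ₗ_)
open import Data.List.Relation.Unary.All using (All)
open import Data.List.Relation.Unary.Unique.Propositional using (Unique)
open import Data.Product using (_×_)
open import Relation.Binary.PropositionalEquality using (_≡_; _≢_)

record Hypergraph (n : ℕ) : Set where
  constructor hypergraph
  field
    edges  : List (Subset n)
    unique : Unique edges
open Hypergraph public

Uniform : ∀ {n} → ℕ → Hypergraph n → Set
Uniform r G = All (λ e → ∣ e ∣ ≡ r) (edges G)

Linear : ∀ {n} → Hypergraph n → Set
Linear G = ∀ {e f} → e ∈ₗ edges G → f ∈ₗ edges G → e ≢ f → ∣ e ∩ f ∣ ≤ 1

degree : ∀ {n} → Hypergraph n → Fin n → ℕ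
degree G v = length (filter (v ∈?_) (edges G))

-- G contains a copy of the k-crown C^r_{1,k} with base edge e:
-- k edges e₁..e_k of G, pairwise disjoint, each different from e and meeting e
-- in exactly one vertex (these vertices are then automatically distinct).
HasCrownAt : ∀ {n} → Hypergraph n → ℕ → Subset n → Set
HasCrownAt {n} G k e =
  Data.Product.Σ (Fin k → Subset n) λ es →
    (∀ i → es i ∈ₗ edges G)
    × (∀ i → es i ≢ e)
    × (∀ i → ∣ es i ∩ e ∣ ≡ 1)
    × (∀ i j → i ≢ j → Empty (es i ∩ es j))

{-# OPTIONS --safe #-}
-- Choose the legs greedily, through v₁, v₂, … in turn, keeping the set S of
-- vertices outside e already used by earlier legs; |S| ≤ (i-1)(r-1) before
-- the leg through vᵢ is chosen. By linearity the edges through vᵢ pairwise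
-- meet only in vᵢ ∉ S, so each vertex of S lies on at most one of them, and
-- as d(vᵢ) ≥ |S| + 2 some edge through vᵢ other than e avoids S. It meets e
-- only in vᵢ, hence also misses the earlier legs.
module Submission where

open import Defs
open import Data.Bool using () renaming (_≟_ to _≟ᵇ_)
open import Data.Fin using (Fin; zero; suc; toℕ) renaming (_≟_ to _≟ᶠ_)
open import Data.Fin.Properties using (0≢1+n; suc-injective)
open import Data.Fin.Subset
  using (Subset; inside; outside; _∈_; _∉_; _⊆_; _∩_; _∪_; _─_; _-_; ∣_∣; ⊥; Nonempty; Empty)
open import Data.Fin.Subset.Properties
  using ( _∈?_; nonempty?; ∉⊥; ∣⊥∣≡0; ∣⁅x⁆∣≡1; x∈⁅y⁆⇒x≡y; p⊆q⇒∣p∣≤∣q∣; x∈p∩q⁺; x∈p∩q⁻; ∩-comm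
        ; x∈p∪q⁺; x∈p∪q⁻; p⊆p∪q; p─q⊆p; x∈p∧x∉q⇒x∈p─q; x∈p∧x≢y⇒x∈p-y
        ; p∩q≢∅⇒∣p─q∣<∣p∣; x∈p⇒∣p-x∣<∣p∣)
open import Data.List using (List; []; _∷_; length; filter)
open import Data.List.Properties using (filter-all)
open import Data.List.Membership.Propositional using (find) renaming (_∈_ to _∈ₗ_)
open import Data.List.Membership.Propositional.Properties using (∈-filter⁻)
open import Data.List.Relation.Unary.Any using (Any; here; there)
open import Data.List.Relation.Unary.All as All using (All; []; _∷_)
open import Data.List.Relation.Unary.All.Properties using (¬All⇒Any¬)
open import Data.List.Relation.Unary.AllPairs as AllPairs using (AllPairs; []; _∷_)
open import Data.List.Relation.Unary.Unique.Propositional using (Unique)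
import Data.List.Relation.Unary.Unique.Propositional.Properties as Unique
open import Data.Nat using (ℕ; zero; suc; _≤_; _<_; _+_; _*_; _∸_; z≤n; s≤s)
open import Data.Nat.Properties
  using ( ≤-trans; ≤-reflexive; ≤-antisym; ≤-<-trans; <-≤-trans; <-irrefl; ≤⇒≯; ≤-pred; n≤1+n
        ; +-comm; +-assoc; +-suc; +-identityʳ; +-monoˡ-≤; +-monoʳ-≤; ∸-monoˡ-≤)
open import Data.Product using (∃; _×_; _,_; swap)
open import Data.Sum using (inj₁; inj₂)
open import Data.Vec using ([]; _∷_)
open import Data.Vec.Properties using (≡-dec)
open import Function using (_∘_)
open import Function.Definitions using (Injective)
open import Relation.Binary.Definitions using (DecidableEquality)
open import Relation.Nullary using (yes; no; ¬?; contradiction)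
open import Relation.Binary.PropositionalEquality using (_≡_; _≢_; refl; sym; cong; subst; ≢-sym)

_≟ˢ_ : ∀ {n} → DecidableEquality (Subset n)
_≟ˢ_ = ≡-dec _≟ᵇ_

x∈p⇒1≤∣p∣ : ∀ {n} {p : Subset n} {x} → x ∈ p → 1 ≤ ∣ p ∣
x∈p⇒1≤∣p∣ {x = x} x∈p =
  subst (_≤ _) (∣⁅x⁆∣≡1 x) (p⊆q⇒∣p∣≤∣q∣ (λ y∈⁅x⁆ → subst (_∈ _) (sym (x∈⁅y⁆⇒x≡y x y∈⁅x⁆)) x∈p))

∣p∣≤1⇒x≡y : ∀ {n} {p : Subset n} {x y} → ∣ p ∣ ≤ 1 → x ∈ p → y ∈ p → x ≡ y
∣p∣≤1⇒x≡y {x = x} {y} ∣p∣≤1 x∈p y∈p with x ≟ᶠ y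
... | yes x≡y = x≡y
... | no x≢y  = contradiction 1<1 (<-irrefl refl)
  where
  1<1 : 1 < 1
  1<1 = ≤-<-trans (x∈p⇒1≤∣p∣ (x∈p∧x≢y⇒x∈p-y x∈p x≢y)) (<-≤-trans (x∈p⇒∣p-x∣<∣p∣ y∈p) ∣p∣≤1)

∣p∪q∣≤∣p∣+∣q∣ : ∀ {n} (p q : Subset n) → ∣ p ∪ q ∣ ≤ ∣ p ∣ + ∣ q ∣
∣p∪q∣≤∣p∣+∣q∣ []            []            = z≤n
∣p∪q∣≤∣p∣+∣q∣ (inside  ∷ p) (inside  ∷ q) = s≤s (≤-trans (∣p∪q∣≤∣p∣+∣q∣ p q) (+-monoʳ-≤ ∣ p ∣ (n≤1+n ∣ q ∣)))
∣p∪q∣≤∣p∣+∣q∣ (inside  ∷ p) (outside ∷ q) = s≤s (∣p∪q∣≤∣p∣+∣q∣ p q)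
∣p∪q∣≤∣p∣+∣q∣ (outside ∷ p) (inside  ∷ q) = ≤-trans (s≤s (∣p∪q∣≤∣p∣+∣q∣ p q)) (≤-reflexive (sym (+-suc ∣ p ∣ ∣ q ∣)))
∣p∪q∣≤∣p∣+∣q∣ (outside ∷ p) (outside ∷ q) = ∣p∪q∣≤∣p∣+∣q∣ p q

Unique⇒AllPairs : ∀ {A : Set} {R : A → A → Set} {xs} → Unique xs
                → (∀ {x y} → x ∈ₗ xs → y ∈ₗ xs → x ≢ y → R x y) → AllPairs R xs
Unique⇒AllPairs []           _    = []
Unique⇒AllPairs (x∉xs ∷ xs!) R-on =
  All.tabulate (λ y∈xs → R-on (here refl) (there y∈xs) (All.lookup x∉xs y∈xs))
  ∷ Unique⇒AllPairs xs! (λ x∈xs y∈xs → R-on (there x∈xs) (there y∈xs))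

length≤1+length-filter≢ : ∀ {A : Set} (_≟_ : DecidableEquality A) (a : A) {xs} → Unique xs
                        → length xs ≤ suc (length (filter (λ x → ¬? (x ≟ a)) xs))
length≤1+length-filter≢ _≟_ a [] = z≤n
length≤1+length-filter≢ _≟_ a {x ∷ xs} (x∉xs ∷ xs!) with x ≟ a
... | yes refl = s≤s (≤-reflexive (cong length (sym (filter-all (λ y → ¬? (y ≟ a)) (All.map ≢-sym x∉xs)))))
... | no _     = s≤s (length≤1+length-filter≢ _≟_ a xs!)

DisjointWithin : ∀ {n} → Subset n → Subset n → Subset n → Set
DisjointWithin S f g = ∀ {w} → w ∈ f → w ∈ g → w ∉ S

length≤∣S∣ : ∀ {n} {S : Subset n} {fs} → AllPairs (DisjointWithin S) fs
           → All (λ f → Nonempty (f ∩ S)) fs → length fs ≤ ∣ S ∣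
length≤∣S∣ [] [] = z≤n
length≤∣S∣ {S = S} {f ∷ fs} (f⊥fs ∷ fs⊥) ((w , w∈f∩S) ∷ fs-meet) =
  ≤-trans (s≤s (length≤∣S∣ (AllPairs.map shrink fs⊥) (All.zipWith meets-S─f (f⊥fs , fs-meet))))
          (p∩q≢∅⇒∣p─q∣<∣p∣ S f (w , x∈p∩q⁺ (swap (x∈p∩q⁻ f S w∈f∩S))))
  where
  shrink : ∀ {g h} → DisjointWithin S g h → DisjointWithin (S ─ f) g h
  shrink g⊥h w∈g w∈h = g⊥h w∈g w∈h ∘ p─q⊆p S f

  meets-S─f : ∀ {g} → DisjointWithin S f g × Nonempty (g ∩ S) → Nonempty (g ∩ (S ─ f))
  meets-S─f {g} (f⊥g , u , u∈g∩S) =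
    let u∈g , u∈S = x∈p∩q⁻ g S u∈g∩S
    in u , x∈p∩q⁺ (u∈g , x∈p∧x∉q⇒x∈p─q u∈S (λ u∈f → f⊥g u∈f u∈g u∈S))

∣S∣<length⇒avoiding : ∀ {n} {S : Subset n} {fs} → AllPairs (DisjointWithin S) fs
                    → ∣ S ∣ < length fs → Any (λ f → Empty (f ∩ S)) fs
∣S∣<length⇒avoiding {S = S} {fs} fs⊥ ∣S∣<∣fs∣ =
  ¬All⇒Any¬ (λ f → nonempty? (f ∩ S)) fs (λ fs-meet → ≤⇒≯ (length≤∣S∣ fs⊥ fs-meet) ∣S∣<∣fs∣)

module _ {n} {r : ℕ} (G : Hypergraph n) (uniform : Uniform r G) (linear : Linear G)
         {e : Subset n} (e∈G : e ∈ₗ edges G) where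

  common-vertex : ∀ {f x y} → f ∈ₗ edges G → f ≢ e → x ∈ f → x ∈ e → y ∈ f → y ∈ e → x ≡ y
  common-vertex f∈G f≢e x∈f x∈e y∈f y∈e =
    ∣p∣≤1⇒x≡y (linear f∈G e∈G f≢e) (x∈p∩q⁺ (x∈f , x∈e)) (x∈p∩q⁺ (y∈f , y∈e))

  record Leg (S : Subset n) (x : Fin n) : Set where
    field
      edge   : Subset n
      edge∈G : edge ∈ₗ edges G
      edge≢e : edge ≢ e
      x∈edge : x ∈ edge
      avoids : Empty (edge ∩ S)
  open Leg

  Leg-antitone : ∀ {S T x} → S ⊆ T → Leg T x → Leg S x
  Leg-antitone {S} S⊆T ℓ = record
    { edge = edge ℓ ; edge∈G = edge∈G ℓ ; edge≢e = edge≢e ℓ ; x∈edge = x∈edge ℓ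
    ; avoids = λ (w , w∈ℓ∩S) → let w∈ℓ , w∈S = x∈p∩q⁻ (edge ℓ) S w∈ℓ∩S
                               in avoids ℓ (w , x∈p∩q⁺ (w∈ℓ , S⊆T w∈S)) }

  leg-avoiding : ∀ {S x} → x ∉ S → ∣ S ∣ + 2 ≤ degree G x → Leg S x
  leg-avoiding {S} {x} x∉S deg = toLeg (find (∣S∣<length⇒avoiding star⊥ ∣S∣<∣star∣))
    where
    star : List (Subset n)
    star = filter (λ f → ¬? (f ≟ˢ e)) (filter (x ∈?_) (edges G))

    star-member : ∀ {f} → f ∈ₗ star → f ∈ₗ edges G × f ≢ e × x ∈ f
    star-member f∈star =
      let f∈G[x] , f≢e = ∈-filter⁻ (λ f → ¬? (f ≟ˢ e)) f∈star
          f∈G , x∈f = ∈-filter⁻ (x ∈?_) f∈G[x]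
      in f∈G , f≢e , x∈f

    star! : Unique (filter (x ∈?_) (edges G))
    star! = Unique.filter⁺ (x ∈?_) (unique G)

    star⊥ : AllPairs (DisjointWithin S) star
    star⊥ = Unique⇒AllPairs (Unique.filter⁺ _ star!) λ f∈star g∈star f≢g w∈f w∈g w∈S →
      let f∈G , _ , x∈f = star-member f∈star
          g∈G , _ , x∈g = star-member g∈star
          w≡x = ∣p∣≤1⇒x≡y (linear f∈G g∈G f≢g) (x∈p∩q⁺ (w∈f , w∈g)) (x∈p∩q⁺ (x∈f , x∈g))
      in x∉S (subst (_∈ S) w≡x w∈S)

    ∣S∣<∣star∣ : ∣ S ∣ < length star
    ∣S∣<∣star∣ = ≤-pred (≤-trans (≤-reflexive (+-comm 2 ∣ S ∣))
                         (≤-trans deg (length≤1+length-filter≢ _≟ˢ_ e star!)))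

    toLeg : (∃ λ f → f ∈ₗ star × Empty (f ∩ S)) → Leg S x
    toLeg (f , f∈star , f∩S=∅) =
      let f∈G , f≢e , x∈f = star-member f∈star
      in record { edge = f ; edge∈G = f∈G ; edge≢e = f≢e ; x∈edge = x∈f ; avoids = f∩S=∅ }

  record Crown {m} (S : Subset n) (v : Fin m → Fin n) : Set where
    field
      leg      : ∀ i → Leg S (v i)
      disjoint : ∀ i j → i ≢ j → Empty (edge (leg i) ∩ edge (leg j))

  crown : ∀ {m} (S : Subset n) (v : Fin m → Fin n) → Injective _≡_ _≡_ v
        → (∀ i → v i ∈ e) → (∀ i → v i ∉ S)
        → (∀ i → ∣ S ∣ + toℕ i * (r ∸ 1) + 2 ≤ degree G (v i))
        → Crown S v
  crown {zero}  S v _     _   _   _   = record { leg = λ () ; disjoint = λ () }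
  crown {suc m} S v v-inj v∈e v∉S deg = record { leg = legs ; disjoint = legs-disjoint }
    where
    first : Leg S (v zero)
    first = leg-avoiding (v∉S zero) (subst (λ s → s + 2 ≤ _) (+-identityʳ ∣ S ∣) (deg zero))

    -- edge first - v zero is the part of the first leg outside e
    S′ : Subset n
    S′ = S ∪ (edge first - v zero)

    ∣first-v₀∣≤r-1 : ∣ edge first - v zero ∣ ≤ r ∸ 1
    ∣first-v₀∣≤r-1 = ∸-monoˡ-≤ 1 (subst (∣ edge first - v zero ∣ <_) (All.lookup uniform (edge∈G first))
                                        (x∈p⇒∣p-x∣<∣p∣ (x∈edge first)))

    ∣S′∣≤∣S∣+r-1 : ∣ S′ ∣ ≤ ∣ S ∣ + (r ∸ 1)
    ∣S′∣≤∣S∣+r-1 = ≤-trans (∣p∪q∣≤∣p∣+∣q∣ S _) (+-monoʳ-≤ ∣ S ∣ ∣first-v₀∣≤r-1)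

    v-suc∉S′ : ∀ i → v (suc i) ∉ S′
    v-suc∉S′ i v∈S′ with x∈p∪q⁻ S _ v∈S′
    ... | inj₁ v∈S     = v∉S (suc i) v∈S
    ... | inj₂ v∈first = 0≢1+n (v-inj (common-vertex (edge∈G first) (edge≢e first)
                           (x∈edge first) (v∈e zero) (p─q⊆p _ _ v∈first) (v∈e (suc i))))

    deg′ : ∀ i → ∣ S′ ∣ + toℕ i * (r ∸ 1) + 2 ≤ degree G (v (suc i))
    deg′ i = ≤-trans (+-monoˡ-≤ 2 (≤-trans (+-monoˡ-≤ (toℕ i * (r ∸ 1)) ∣S′∣≤∣S∣+r-1)
                                           (≤-reflexive (+-assoc ∣ S ∣ (r ∸ 1) _))))
                     (deg (suc i))

    rest : Crown S′ (v ∘ suc)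
    rest = crown S′ (v ∘ suc) (suc-injective ∘ v-inj) (v∈e ∘ suc) v-suc∉S′ deg′

    legs : ∀ i → Leg S (v i)
    legs zero    = first
    legs (suc i) = Leg-antitone (p⊆p∪q _) (Crown.leg rest i)

    first⊥ : ∀ {i} (ℓ : Leg S′ (v (suc i))) → Empty (edge first ∩ edge ℓ)
    first⊥ {i} ℓ (w , w∈) with x∈p∩q⁻ (edge first) (edge ℓ) w∈ | w ≟ᶠ v zero
    ... | _       , w∈ℓ | yes refl = 0≢1+n (v-inj (common-vertex (edge∈G ℓ) (edge≢e ℓ)
                                       w∈ℓ (v∈e zero) (x∈edge ℓ) (v∈e (suc i))))
    ... | w∈first , w∈ℓ | no w≢v₀  = avoids ℓ (w , x∈p∩q⁺ (w∈ℓ , x∈p∪q⁺ (inj₂ (x∈p∧x≢y⇒x∈p-y w∈first w≢v₀))))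

    legs-disjoint : ∀ i j → i ≢ j → Empty (edge (legs i) ∩ edge (legs j))
    legs-disjoint zero    zero    0≢0 = contradiction refl 0≢0
    legs-disjoint zero    (suc j) _   = first⊥ (Crown.leg rest j)
    legs-disjoint (suc i) zero    _   = subst Empty (∩-comm _ _) (first⊥ (Crown.leg rest i))
    legs-disjoint (suc i) (suc j) i≢j = Crown.disjoint rest i j (i≢j ∘ cong suc)

  Crown⇒HasCrownAt : ∀ {m S} {v : Fin m → Fin n} → (∀ i → v i ∈ e) → Crown S v → HasCrownAt G m e
  Crown⇒HasCrownAt v∈e c = edge ∘ leg , edge∈G ∘ leg , edge≢e ∘ leg , meets-e-once , disjoint
    where
    open Crown c
    meets-e-once : ∀ i → ∣ edge (leg i) ∩ e ∣ ≡ 1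
    meets-e-once i = ≤-antisym (linear (edge∈G (leg i)) e∈G (edge≢e (leg i)))
                               (x∈p⇒1≤∣p∣ (x∈p∩q⁺ (x∈edge (leg i) , v∈e i)))

lemma1 : ∀ {n} (r : ℕ) (G : Hypergraph n) → Uniform r G → Linear G
       → (k : ℕ) → 1 ≤ k → k ≤ r
       → (e : Subset n) → e ∈ₗ edges G
       → (v : Fin k → Fin n) → Injective _≡_ _≡_ v
       → (∀ i → v i ∈ e)
       → (∀ i → toℕ i * (r ∸ 1) + 2 ≤ degree G (v i))
       → HasCrownAt G k e
lemma1 {n} r G uniform linear k _ _ e e∈G v v-inj v∈e deg =
  Crown⇒HasCrownAt G uniform linear e∈G v∈e (crown G uniform linear e∈G ⊥ v v-inj v∈e (λ _ → ∉⊥) deg⊥)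
  where
  deg⊥ : ∀ i → ∣ ⊥ {n = n} ∣ + toℕ i * (r ∸ 1) + 2 ≤ degree G (v i)
  deg⊥ i = subst (λ s → s + toℕ i * (r ∸ 1) + 2 ≤ degree G (v i)) (sym (∣⊥∣≡0 n)) (deg i)
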